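{- Let $e$ be an even positive integer and $q=2^e$. Let $\mathcal T=\{A\in\mathbb{F}_q:\operatorname{Tr}_q(A)=1\}$ and $P(A)=A+A^{ -1}+A^{ -2}$ for $A\in\mathcal T$. Then $P$ is a permutation of $\mathcal T$. In particular, $\operatorname{Tr}_q(P(A))=1$ for all $A\in\mathcal T$.
   Context: $\operatorname{Tr}_q$ is the absolute trace from $\mathbb{F}_q$ to $\mathbb{F}_2$ (note $0\notin\mathcal T$ since $\operatorname{Tr}_q(0)=0$). -}

module Defs where

open import Level using (Level; _⊔_)
open import Data.Nat using (ℕ; zero; suc)
import Data.Nat as ℕ
open import Data.Fin using (Fin)
open import Data.Product using (Σ; _×_)
open import Relation.Nullary using (¬_)
open import Algebra.Bundles using (CommutativeRing)
open import Function.Bundles using (Inverse)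
import Relation.Binary.PropositionalEquality as ≡

module _ {c ℓ : Level} (R : CommutativeRing c ℓ) where
  open CommutativeRing R

  -- R (with the given inversion map) is a field with exactly q elements
  -- (up to its setoid equality ≈).  The value of inv at 0 is irrelevant.
  record IsFiniteFieldOfOrder (q : ℕ) (inv : Carrier → Carrier) : Set (c ⊔ ℓ) where
    field
      1≉0      : ¬ (1# ≈ 0#)
      inverseʳ : ∀ x → ¬ (x ≈ 0#) → x * inv x ≈ 1#
      card     : Inverse (≡.setoid (Fin q)) setoid

  pow : Carrier → ℕ → Carrier
  pow x zero    = 1#
  pow x (suc n) = x * pow x n

  trace : ℕ → Carrier → Carrier
  trace zero    A = 0#
  trace (suc i) A = trace i A + pow A (2 ℕ.^ i)

  P : (Carrier → Carrier) → Carrier → Carrier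
  P inv A = A + inv A + pow (inv A) 2

{-# OPTIONS --safe #-}
-- In a field with q = 2^e elements x^q = x; for x = -1 this gives -1 = 1, as q is even,
-- so the characteristic is 2. The trace is then additive and Tr (x²) = Tr x, so
-- Tr (y² + y) = 0; in particular Tr (P A) = Tr A + Tr (A⁻² + A⁻¹) = Tr A. Suppose
-- P A = P B with A ≠ B, and put a = A⁻¹, b = B⁻¹, t = (a + b)⁻¹. Then A B = a + b + 1,
-- whence A = ab + (b² + b) and ab t² = ab + (t² + t), while y = a t solves y² + y = ab t².
-- Taking traces, 1 = Tr A = Tr (ab) = Tr (ab t²) = 0. Finally, an injective self-map of
-- the finite set of trace-one elements is onto.
module Submission where

open import Defs
open import Level using (Level)
import Data.Nat as ℕ
import Data.Nat.Properties as ℕ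
open import Data.Nat using (ℕ; zero; suc)
open import Data.Bool using (Bool; true; false; if_then_else_; _xor_; _∧_)
import Data.Bool as Bool
open import Data.Bool.Properties using (xor-∧-commutativeRing)
open import Data.Fin using (Fin; zero; suc; punchIn; punchOut)
import Data.Fin as Fin
open import Data.Fin.Properties
  using (any?; injective⇒≤; punchOut-injective; punchInᵢ≢i; inj⇒≟)
open import Data.Fin.Permutation using (Permutation′)
open import Data.Vec.Functional using (replicate; updateAt; removeAt)
open import Data.Vec.Functional.Properties using (updateAt-updates; updateAt-minimal)
open import Data.Maybe using (Maybe; just; nothing)
open import Data.Product using (Σ; _×_; _,_; ∃)
open import Function using (_∘_; const)
open import Function.Bundles using (Inverse; Injection)
open import Function.Definitions using (Injective)
open import Function.Properties.Inverse using (Inverse⇒Injection)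
import Function.Construct.Composition as Composition
import Function.Construct.Symmetry as Symmetry
open import Relation.Nullary using (¬_; yes; no; contradiction)
open import Relation.Unary using (Pred)
import Relation.Unary as U
open import Relation.Binary using (Setoid; Decidable; _Respects_)
open import Relation.Binary.PropositionalEquality using (_≡_; _≢_)
import Relation.Binary.PropositionalEquality as ≡
open import Algebra.Bundles using (CommutativeRing; CommutativeMonoid)
open import Algebra.Solver.Ring.AlmostCommutativeRing
  using (fromCommutativeSemiring; _-Raw-AlmostCommutative⟶_)

Fin-injective⇒surjective : ∀ {n} {f : Fin n → Fin n} → Injective _≡_ _≡_ f →
                           ∀ y → ∃ λ x → f x ≡ y
Fin-injective⇒surjective {zero} _ ()
Fin-injective⇒surjective {suc n} {f} f-injective y with any? (λ x → f x Fin.≟ y)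
... | yes hit = hit
... | no miss = contradiction (injective⇒≤ punchOut∘f-injective) ℕ.1+n≰n
  where
  y≢f : ∀ x → y ≢ f x
  y≢f x y≡fx = miss (x , ≡.sym y≡fx)

  punchOut∘f-injective : Injective _≡_ _≡_ (λ x → punchOut (y≢f x))
  punchOut∘f-injective eq = f-injective (punchOut-injective (y≢f _) (y≢f _) eq)

module _ {a ℓ} (M : CommutativeMonoid a ℓ) where
  open CommutativeMonoid M
  open import Algebra.Properties.CommutativeMonoid.Sum M
    using (sum; sum-remove; sum-cong-≋; sum-replicate-zero)
  open import Algebra.Properties.Monoid monoid using (introʳ; elimʳ)
  open import Algebra.Properties.CommutativeSemigroup commutativeSemigroup using (x∙yz≈y∙xz)
  open import Relation.Binary.Reasoning.Setoid setoid

  sum-updateAt-replicate-ε : ∀ {n} (i : Fin n) x →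
                             sum (updateAt (replicate n ε) i (const x)) ≈ x
  sum-updateAt-replicate-ε {suc n} i x = begin
    sum t                      ≈⟨ sum-remove {i = i} t ⟩
    t i ∙ sum (removeAt t i)   ≈⟨ ∙-cong (reflexive (updateAt-updates i _))
                                         (sum-cong-≋ ε-elsewhere) ⟩
    x ∙ sum (replicate n ε)    ≈⟨ ∙-congˡ (sum-replicate-zero n) ⟩
    x ∙ ε                      ≈⟨ identityʳ x ⟩
    x                          ∎
    where
    t = updateAt (replicate (suc n) ε) i (const x)

    ε-elsewhere : ∀ j → t (punchIn i j) ≈ ε
    ε-elsewhere j = reflexive (updateAt-minimal (punchIn i j) i _ (punchInᵢ≢i i j))

  inverse-unique : ∀ {a x y} → x ∙ a ≈ ε → y ∙ a ≈ ε → x ≈ y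
  inverse-unique {a} {x} {y} xa≈ε ya≈ε = begin
    x              ≈⟨ introʳ ya≈ε x ⟩
    x ∙ (y ∙ a)    ≈⟨ x∙yz≈y∙xz x y a ⟩
    y ∙ (x ∙ a)    ≈⟨ elimʳ xa≈ε y ⟩
    y              ∎

module FiniteSetoid {a ℓ n} {S : Setoid a ℓ} (card : Inverse (≡.setoid (Fin n)) S) where
  open Setoid S
  open Inverse card using (to; from; inverseˡ)

  from-injection : Injection S (≡.setoid (Fin n))
  from-injection = Inverse⇒Injection (Symmetry.inverse card)

  from-injective : ∀ {x y} → from x ≡ from y → x ≈ y
  from-injective = Injection.injective from-injection

  to-injective : ∀ {i j} → to i ≈ to j → i ≡ j
  to-injective = Injection.injective (Inverse⇒Injection card)

  infix 4 _≟_
  _≟_ : Decidable _≈_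
  _≟_ = inj⇒≟ from-injection

  permutationOf : Inverse S S → Permutation′ n
  permutationOf π = Composition.inverse (Composition.inverse card π) (Symmetry.inverse card)

  module _ {p} {T : Pred Carrier p} (T? : U.Decidable T) (T-resp-≈ : T Respects _≈_)
           {f : Carrier → Carrier} (f-closed : ∀ {x} → T x → T (f x))
           (f-injective : ∀ {x y} → T x → T y → f x ≈ f y → x ≈ y) where

    private
      extended : Fin n → Fin n
      extended i with T? (to i)
      ... | yes _ = from (f (to i))
      ... | no _  = i

      stays-in-T : ∀ {i j} → T (to i) → from (f (to i)) ≡ j → T (to j)
      stays-in-T Ti eq = T-resp-≈ (sym (inverseˡ (≡.sym eq))) (f-closed Ti)

      extended-injective : Injective _≡_ _≡_ extended
      extended-injective {i} {j} eq with T? (to i) | T? (to j)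
      ... | yes Ti | yes Tj = to-injective (f-injective Ti Tj (from-injective eq))
      ... | yes Ti | no ¬Tj = contradiction (stays-in-T Ti eq) ¬Tj
      ... | no ¬Ti | yes Tj = contradiction (stays-in-T Tj (≡.sym eq)) ¬Ti
      ... | no _   | no _   = eq

    surjectiveOn : ∀ {y} → T y → ∃ λ x → T x × f x ≈ y
    surjectiveOn {y} Ty with Fin-injective⇒surjective extended-injective (from y)
    ... | i , eq with T? (to i)
    ...   | yes Ti = to i , Ti , from-injective eq
    ...   | no ¬Ti = contradiction (T-resp-≈ (sym (inverseˡ eq)) Ty) ¬Ti

HasCharacteristicTwo : ∀ {c ℓ} → CommutativeRing c ℓ → Set ℓ
HasCharacteristicTwo R = 1# + 1# ≈ 0#
  where open CommutativeRing R

module CharacteristicTwo {c ℓ : Level} (R : CommutativeRing c ℓ)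
                         (char-2 : HasCharacteristicTwo R) where
  open CommutativeRing R hiding (zero)
  open import Algebra.Properties.CommutativeSemiring.Exp commutativeSemiring
    using (_^_; ^-congˡ; ^-congʳ; ^-homo-*; ^-distrib-*)
  open import Algebra.Properties.Monoid *-monoid using (cancelʳ; insertʳ; introʳ)
  open import Relation.Binary.Reasoning.Setoid setoid

  -- Identities valid in characteristic 2 are proved by the ring solver with coefficients in
  -- 𝔽₂ = (Bool, xor, ∧); negation never occurs, so R is read as a semiring with - = id.
  private
    𝔽₂ = CommutativeRing.rawRing xor-∧-commutativeRing

    ⟦_⟧ : Bool → Carrier
    ⟦ b ⟧ = if b then 1# else 0#

    𝔽₂-morphism : 𝔽₂ -Raw-AlmostCommutative⟶ fromCommutativeSemiring commutativeSemiring
    𝔽₂-morphism = record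
      { ⟦_⟧    = ⟦_⟧
      ; +-homo = +-homo
      ; *-homo = *-homo
      ; -‿homo = λ _ → refl
      ; 0-homo = refl
      ; 1-homo = refl
      }
      where
      +-homo : ∀ a b → ⟦ a xor b ⟧ ≈ ⟦ a ⟧ + ⟦ b ⟧
      +-homo false b     = sym (+-identityˡ _)
      +-homo true  false = sym (+-identityʳ _)
      +-homo true  true  = sym char-2

      *-homo : ∀ a b → ⟦ a ∧ b ⟧ ≈ ⟦ a ⟧ * ⟦ b ⟧
      *-homo false b = sym (zeroˡ _)
      *-homo true  b = sym (*-identityˡ _)

    _≟𝔽₂_ : ∀ a b → Maybe (⟦ a ⟧ ≈ ⟦ b ⟧)
    a ≟𝔽₂ b with a Bool.≟ b
    ... | yes ≡.refl = just refl
    ... | no _       = nothing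

  open import Algebra.Solver.Ring 𝔽₂ (fromCommutativeSemiring commutativeSemiring)
    𝔽₂-morphism _≟𝔽₂_ using (solve; _:+_; _:*_; _:=_; con)

  x+x≈0 : ∀ x → x + x ≈ 0#
  x+x≈0 = solve 1 (λ x → x :+ x := con false) refl

  x+y≈0⇒x≈y : ∀ {x y} → x + y ≈ 0# → x ≈ y
  x+y≈0⇒x≈y {x} {y} x+y≈0 = begin
    x             ≈⟨ solve 2 (λ x y → x := (x :+ y) :+ y) refl x y ⟩
    (x + y) + y   ≈⟨ +-congʳ x+y≈0 ⟩
    0# + y        ≈⟨ +-identityˡ y ⟩
    y             ∎

  x≈y⇒x+y≈0 : ∀ {x y} → x ≈ y → x + y ≈ 0#
  x≈y⇒x+y≈0 {x} {y} x≈y = trans (+-congʳ x≈y) (x+x≈0 y)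

  ^-double : ∀ x k → x ^ (2 ℕ.* k) ≈ x ^ k * x ^ k
  ^-double x k = trans (^-homo-* x k (1 ℕ.* k)) (*-congˡ (^-congʳ x (ℕ.*-identityˡ k)))

  ^2^-homo-+ : ∀ i x y → (x + y) ^ (2 ℕ.^ i) ≈ x ^ (2 ℕ.^ i) + y ^ (2 ℕ.^ i)
  ^2^-homo-+ zero x y =
    solve 2 (λ x y → (x :+ y) :* con true := x :* con true :+ y :* con true) refl x y
  ^2^-homo-+ (suc i) x y = begin
    (x + y) ^ (2 ℕ.* k)                 ≈⟨ ^-double (x + y) k ⟩
    (x + y) ^ k * (x + y) ^ k           ≈⟨ *-cong (^2^-homo-+ i x y) (^2^-homo-+ i x y) ⟩
    (x ^ k + y ^ k) * (x ^ k + y ^ k)   ≈⟨ solve 2 (λ u v → (u :+ v) :* (u :+ v) := u :* u :+ v :* v)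
                                                 refl (x ^ k) (y ^ k) ⟩
    x ^ k * x ^ k + y ^ k * y ^ k       ≈⟨ +-cong (^-double x k) (^-double y k) ⟨
    x ^ (2 ℕ.* k) + y ^ (2 ℕ.* k)       ∎
    where k = 2 ℕ.^ i

  pow≡^ : ∀ x n → pow R x n ≡ x ^ n
  pow≡^ x zero    = ≡.refl
  pow≡^ x (suc n) = ≡.cong (x *_) (pow≡^ x n)

  trace-cong : ∀ i {x y} → x ≈ y → trace R i x ≈ trace R i y
  trace-cong zero    x≈y = refl
  trace-cong (suc i) {x} {y} x≈y rewrite pow≡^ x (2 ℕ.^ i) | pow≡^ y (2 ℕ.^ i) =
    +-cong (trace-cong i x≈y) (^-congˡ (2 ℕ.^ i) x≈y)

  trace-homo-+ : ∀ i x y → trace R i (x + y) ≈ trace R i x + trace R i y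
  trace-homo-+ zero    x y = sym (+-identityˡ 0#)
  trace-homo-+ (suc i) x y
    rewrite pow≡^ (x + y) (2 ℕ.^ i) | pow≡^ x (2 ℕ.^ i) | pow≡^ y (2 ℕ.^ i) = begin
      trace R i (x + y) + (x + y) ^ k
        ≈⟨ +-cong (trace-homo-+ i x y) (^2^-homo-+ i x y) ⟩
      (trace R i x + trace R i y) + (x ^ k + y ^ k)
        ≈⟨ solve 4 (λ a b c d → (a :+ b) :+ (c :+ d) := (a :+ c) :+ (b :+ d)) refl _ _ _ _ ⟩
      (trace R i x + x ^ k) + (trace R i y + y ^ k)
        ∎
    where k = 2 ℕ.^ i

  trace-0 : ∀ i → trace R i 0# ≈ 0#
  trace-0 i = begin
    trace R i 0#                  ≈⟨ trace-cong i (+-identityˡ 0#) ⟨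
    trace R i (0# + 0#)           ≈⟨ trace-homo-+ i 0# 0# ⟩
    trace R i 0# + trace R i 0#   ≈⟨ x+x≈0 (trace R i 0#) ⟩
    0#                            ∎

  trace-square-shift : ∀ i x → trace R i (x * x) + x ≈ trace R i x + x ^ (2 ℕ.^ i)
  trace-square-shift zero    x = solve 1 (λ x → con false :+ x := con false :+ x :* con true) refl x
  trace-square-shift (suc i) x rewrite pow≡^ (x * x) (2 ℕ.^ i) | pow≡^ x (2 ℕ.^ i) = begin
    trace R i (x * x) + (x * x) ^ k + x
      ≈⟨ solve 3 (λ s p x → s :+ p :+ x := s :+ x :+ p) refl _ _ x ⟩
    trace R i (x * x) + x + (x * x) ^ k   ≈⟨ +-cong (trace-square-shift i x) (^-distrib-* x x k) ⟩
    trace R i x + x ^ k + x ^ k * x ^ k   ≈⟨ +-congˡ (^-double x k) ⟨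
    trace R i x + x ^ k + x ^ (2 ℕ.* k)   ∎
    where k = 2 ℕ.^ i

  module Collision {A a B b t : Carrier} (Aa≈1 : A * a ≈ 1#) (Bb≈1 : B * b ≈ 1#)
                   ([a+b]t≈1 : (a + b) * t ≈ 1#) (collide : A + a + a * a ≈ B + b + b * b) where

    AB≈a+b+1 : A * B ≈ a + b + 1#
    AB≈a+b+1 = begin
      A * B                        ≈⟨ insertʳ [a+b]t≈1 (A * B) ⟩
      A * B * (a + b) * t          ≈⟨ *-congʳ AB[a+b]≈[a+b+1][a+b] ⟩
      (a + b + 1#) * (a + b) * t   ≈⟨ cancelʳ [a+b]t≈1 (a + b + 1#) ⟩
      a + b + 1#                   ∎
      where
      B+A≈[a+b+1][a+b] : B + A ≈ (a + b + 1#) * (a + b)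
      B+A≈[a+b+1][a+b] = x+y≈0⇒x≈y (begin
        B + A + (a + b + 1#) * (a + b)
          ≈⟨ solve 4 (λ A a B b → B :+ A :+ (a :+ b :+ con true) :* (a :+ b)
                                  := (A :+ a :+ a :* a) :+ (B :+ b :+ b :* b)) refl A a B b ⟩
        (A + a + a * a) + (B + b + b * b)
          ≈⟨ x≈y⇒x+y≈0 collide ⟩
        0#
          ∎)

      AB[a+b]≈[a+b+1][a+b] : A * B * (a + b) ≈ (a + b + 1#) * (a + b)
      AB[a+b]≈[a+b+1][a+b] = begin
        A * B * (a + b)             ≈⟨ solve 4 (λ A a B b → A :* B :* (a :+ b)
                                                   := B :* (A :* a) :+ A :* (B :* b)) refl A a B b ⟩
        B * (A * a) + A * (B * b)   ≈⟨ +-cong (*-congˡ Aa≈1) (*-congˡ Bb≈1) ⟩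
        B * 1# + A * 1#             ≈⟨ +-cong (*-identityʳ B) (*-identityʳ A) ⟩
        B + A                       ≈⟨ B+A≈[a+b+1][a+b] ⟩
        (a + b + 1#) * (a + b)      ∎

    A≈ab+[b²+b] : A ≈ a * b + (b * b + b)
    A≈ab+[b²+b] = begin
      A                     ≈⟨ introʳ Bb≈1 A ⟩
      A * (B * b)           ≈⟨ *-assoc A B b ⟨
      A * B * b             ≈⟨ *-congʳ AB≈a+b+1 ⟩
      (a + b + 1#) * b      ≈⟨ solve 2 (λ a b → (a :+ b :+ con true) :* b := a :* b :+ (b :* b :+ b))
                                     refl a b ⟩
      a * b + (b * b + b)   ∎

    ab[t+1]≈t : a * b * (t + 1#) ≈ t
    ab[t+1]≈t = begin
      a * b * (t + 1#)            ≈⟨ *-congˡ (+-congˡ [a+b]t≈1) ⟨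
      a * b * (t + (a + b) * t)   ≈⟨ solve 3 (λ a b t → a :* b :* (t :+ (a :+ b) :* t)
                                                 := a :* b :* (a :+ b :+ con true) :* t) refl a b t ⟩
      a * b * (a + b + 1#) * t    ≈⟨ *-congʳ (*-congˡ AB≈a+b+1) ⟨
      a * b * (A * B) * t         ≈⟨ *-congʳ (solve 4 (λ A a B b → a :* b :* (A :* B)
                                                          := (A :* a) :* (B :* b)) refl A a B b) ⟩
      (A * a) * (B * b) * t       ≈⟨ *-congʳ (*-cong Aa≈1 Bb≈1) ⟩
      1# * 1# * t                 ≈⟨ solve 1 (λ t → con true :* con true :* t := t) refl t ⟩
      t                           ∎

    abt²≈ab+[t²+t] : a * b * (t * t) ≈ a * b + (t * t + t)
    abt²≈ab+[t²+t] = begin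
      a * b * (t * t)                       ≈⟨ solve 3 (λ a b t → a :* b :* (t :* t)
                                                 := a :* b :+ a :* b :* (t :+ con true) :* (t :+ con true))
                                                 refl a b t ⟩
      a * b + a * b * (t + 1#) * (t + 1#)   ≈⟨ +-congˡ (*-congʳ ab[t+1]≈t) ⟩
      a * b + t * (t + 1#)                  ≈⟨ +-congˡ (solve 1 (λ t → t :* (t :+ con true)
                                                                  := t :* t :+ t) refl t) ⟩
      a * b + (t * t + t)                   ∎

    abt²≈[at]²+at : a * b * (t * t) ≈ a * t * (a * t) + a * t
    abt²≈[at]²+at = begin
      a * b * (t * t)                           ≈⟨ solve 3 (λ a b t → a :* b :* (t :* t)
                                                     := a :* t :* (a :* t) :+ a :* t :* ((a :+ b) :* t))
                                                     refl a b t ⟩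
      a * t * (a * t) + a * t * ((a + b) * t)   ≈⟨ +-congˡ (*-congˡ [a+b]t≈1) ⟩
      a * t * (a * t) + a * t * 1#              ≈⟨ +-congˡ (*-identityʳ (a * t)) ⟩
      a * t * (a * t) + a * t                   ∎

module FiniteField {c ℓ : Level} (R : CommutativeRing c ℓ)
                   (inv : CommutativeRing.Carrier R → CommutativeRing.Carrier R)
                   {q : ℕ} (F : IsFiniteFieldOfOrder R q inv) where
  open CommutativeRing R hiding (zero)
  open IsFiniteFieldOfOrder F
  open FiniteSetoid card public using (_≟_; surjectiveOn)
  open FiniteSetoid card using (permutationOf; to-injective)
  open Inverse card using (to; from; strictlyInverseˡ)
  open import Algebra.Properties.Ring ring using (-1*x≈-x; -‿involutive)
  open import Algebra.Properties.Monoid *-monoid using (cancelˡ; cancelʳ; insertʳ)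
  open import Algebra.Properties.CommutativeSemiring.Exp commutativeSemiring
    using (_^_; ^-congˡ; ^-assocʳ)
  open import Algebra.Properties.CommutativeMonoid.Sum *-commutativeMonoid
    using (sum-cong-≋; sum-replicate; sum-replicate-zero; ∑-distrib-+; ∑-permute)
    renaming (sum to ∏)
  open import Relation.Binary.Reasoning.Setoid setoid

  x⁻¹x≈1 : ∀ {x} → ¬ x ≈ 0# → inv x * x ≈ 1#
  x⁻¹x≈1 {x} x≉0 = trans (*-comm (inv x) x) (inverseʳ x x≉0)

  *-≉0 : ∀ {x y} → ¬ x ≈ 0# → ¬ y ≈ 0# → ¬ x * y ≈ 0#
  *-≉0 {x} {y} x≉0 y≉0 xy≈0 = y≉0 (begin
    y                 ≈⟨ cancelˡ (x⁻¹x≈1 x≉0) y ⟨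
    inv x * (x * y)   ≈⟨ *-congˡ xy≈0 ⟩
    inv x * 0#        ≈⟨ zeroʳ (inv x) ⟩
    0#                ∎)

  *-cancelʳ-≉0 : ∀ {w x y} → ¬ w ≈ 0# → x * w ≈ y * w → x ≈ y
  *-cancelʳ-≉0 {w} {x} {y} w≉0 xw≈yw = begin
    x               ≈⟨ insertʳ (inverseʳ w w≉0) x ⟩
    x * w * inv w   ≈⟨ *-congʳ xw≈yw ⟩
    y * w * inv w   ≈⟨ cancelʳ (inverseʳ w w≉0) y ⟩
    y               ∎

  ∏-≉0 : ∀ {n} (t : Fin n → Carrier) → (∀ i → ¬ t i ≈ 0#) → ¬ ∏ t ≈ 0#
  ∏-≉0 {zero}  t t≉0 = 1≉0
  ∏-≉0 {suc n} t t≉0 = *-≉0 (t≉0 zero) (∏-≉0 (t ∘ suc) (t≉0 ∘ suc))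

  scaling : ∀ {x} → ¬ x ≈ 0# → Inverse setoid setoid
  scaling {x} x≉0 = record
    { to        = x *_
    ; from      = inv x *_
    ; to-cong   = *-congˡ
    ; from-cong = *-congˡ
    ; inverse   = (λ {y} z≈x⁻¹y → trans (*-congˡ z≈x⁻¹y) (cancelˡ (inverseʳ x x≉0) y))
                , (λ {y} z≈xy → trans (*-congˡ z≈xy) (cancelˡ (x⁻¹x≈1 x≉0) y))
    }

  0↦1 : Carrier → Carrier
  0↦1 y with y ≟ 0#
  ... | yes _ = 1#
  ... | no _  = y

  0↦1-≉0 : ∀ y → ¬ 0↦1 y ≈ 0#
  0↦1-≉0 y with y ≟ 0#
  ... | yes _  = 1≉0
  ... | no y≉0 = y≉0

  0↦1-of-0 : ∀ {y} → y ≈ 0# → 0↦1 y ≈ 1#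
  0↦1-of-0 {y} y≈0 with y ≟ 0#
  ... | yes _  = refl
  ... | no y≉0 = contradiction y≈0 y≉0

  0↦1-of-≉0 : ∀ {y} → ¬ y ≈ 0# → 0↦1 y ≈ y
  0↦1-of-≉0 {y} y≉0 with y ≟ 0#
  ... | yes y≈0 = contradiction y≈0 y≉0
  ... | no _    = refl

  private
    g : Fin q → Carrier
    g = 0↦1 ∘ to

    z : Fin q
    z = from 0#

  -- Multiplication by x permutes F (σ). As x * g y ≈ g (x * y) except at y = 0, where a factor
  -- x is left over (δ), comparing ∏ g with its permuted copy gives x ^ q * ∏ g ≈ x * ∏ g.
  module _ {x} (x≉0 : ¬ x ≈ 0#) where
    private
      π : Permutation′ q
      π = permutationOf (scaling x≉0)

      σ : Fin q → Fin q
      σ = Inverse.to π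

      δ : Fin q → Carrier
      δ = updateAt (replicate q 1#) z (const x)

      to-σ : ∀ i → to (σ i) ≈ x * to i
      to-σ i = strictlyInverseˡ (x * to i)

      x*g≈g∘σ*δ : ∀ i → x * g i ≈ g (σ i) * δ i
      x*g≈g∘σ*δ i with i Fin.≟ z
      ... | yes ≡.refl = begin
        x * g z         ≈⟨ *-congˡ (0↦1-of-0 (strictlyInverseˡ 0#)) ⟩
        x * 1#          ≈⟨ *-comm x 1# ⟩
        1# * x          ≈⟨ *-cong (sym (0↦1-of-0 to-σz≈0))
                                  (reflexive (≡.sym (updateAt-updates z _))) ⟩
        g (σ z) * δ z   ∎
        where
        to-σz≈0 : to (σ z) ≈ 0#
        to-σz≈0 = trans (to-σ z) (trans (*-congˡ (strictlyInverseˡ 0#)) (zeroʳ x))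
      ... | no i≢z = begin
        x * g i         ≈⟨ *-congˡ (0↦1-of-≉0 to-i≉0) ⟩
        x * to i        ≈⟨ to-σ i ⟨
        to (σ i)        ≈⟨ 0↦1-of-≉0 to-σi≉0 ⟨
        g (σ i)         ≈⟨ *-identityʳ (g (σ i)) ⟨
        g (σ i) * 1#    ≈⟨ *-congˡ (reflexive (≡.sym (updateAt-minimal i z _ i≢z))) ⟩
        g (σ i) * δ i   ∎
        where
        to-i≉0 : ¬ to i ≈ 0#
        to-i≉0 to-i≈0 = i≢z (to-injective (trans to-i≈0 (sym (strictlyInverseˡ 0#))))

        to-σi≉0 : ¬ to (σ i) ≈ 0#
        to-σi≉0 to-σi≈0 = *-≉0 x≉0 to-i≉0 (trans (sym (to-σ i)) to-σi≈0)

    fermat-≉0 : x ^ q ≈ x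
    fermat-≉0 = *-cancelʳ-≉0 (∏-≉0 g (0↦1-≉0 ∘ to)) (begin
      x ^ q * ∏ g               ≈⟨ *-congʳ (sum-replicate q) ⟨
      ∏ (replicate q x) * ∏ g   ≈⟨ ∑-distrib-+ (replicate q x) g ⟨
      ∏ (λ i → x * g i)         ≈⟨ sum-cong-≋ x*g≈g∘σ*δ ⟩
      ∏ (λ i → g (σ i) * δ i)   ≈⟨ ∑-distrib-+ (g ∘ σ) δ ⟩
      ∏ (g ∘ σ) * ∏ δ           ≈⟨ *-cong (sym (∑-permute g π))
                                          (sum-updateAt-replicate-ε *-commutativeMonoid z x) ⟩
      ∏ g * x                   ≈⟨ *-comm (∏ g) x ⟩
      x * ∏ g                   ∎)

  fermat : ∀ x → x ^ q ≈ x
  fermat x with x ≟ 0#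
  ... | no x≉0  = fermat-≉0 x≉0
  ... | yes x≈0 = begin
    x ^ q    ≈⟨ ^-congˡ q x≈0 ⟩
    0# ^ q   ≈⟨ 0^n≈0 z ⟩
    0#       ≈⟨ x≈0 ⟨
    x        ∎
    where
    0^n≈0 : ∀ {n} → Fin n → 0# ^ n ≈ 0#
    0^n≈0 {suc n} _ = zeroˡ (0# ^ n)

  even-order⇒characteristic-2 : ∀ k → q ≡ 2 ℕ.* k → HasCharacteristicTwo R
  even-order⇒characteristic-2 k q≡2k = begin
    1# + 1#     ≈⟨ +-congˡ -1≈1 ⟨
    1# + - 1#   ≈⟨ -‿inverseʳ 1# ⟩
    0#          ∎
    where
    [-1]²≈1 : (- 1#) ^ 2 ≈ 1#
    [-1]²≈1 = trans (*-congˡ (*-identityʳ (- 1#))) (trans (-1*x≈-x (- 1#)) (-‿involutive 1#))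

    -1≈1 : - 1# ≈ 1#
    -1≈1 = begin
      - 1#                 ≈⟨ fermat (- 1#) ⟨
      (- 1#) ^ q           ≡⟨ ≡.cong ((- 1#) ^_) q≡2k ⟩
      (- 1#) ^ (2 ℕ.* k)   ≈⟨ ^-assocʳ (- 1#) 2 k ⟨
      ((- 1#) ^ 2) ^ k     ≈⟨ ^-congˡ k [-1]²≈1 ⟩
      1# ^ k               ≈⟨ sum-replicate k ⟨
      ∏ (replicate k 1#)   ≈⟨ sum-replicate-zero k ⟩
      1#                   ∎

module BinaryField {c ℓ : Level} (R : CommutativeRing c ℓ)
                   (inv : CommutativeRing.Carrier R → CommutativeRing.Carrier R)
                   (e : ℕ) (F : IsFiniteFieldOfOrder R (2 ℕ.^ suc e) inv) where
  open CommutativeRing R hiding (zero)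
  open IsFiniteFieldOfOrder F using (1≉0; inverseʳ)
  open FiniteField R inv F using (_≟_; surjectiveOn; fermat; even-order⇒characteristic-2)
  open CharacteristicTwo R (even-order⇒characteristic-2 (2 ℕ.^ e) ≡.refl)
  open import Algebra.Properties.Ring ring using (+-cancelʳ)
  open import Relation.Binary.Reasoning.Setoid setoid

  Tr : Carrier → Carrier
  Tr = trace R (suc e)

  Tr-cong : ∀ {x y} → x ≈ y → Tr x ≈ Tr y
  Tr-cong = trace-cong (suc e)

  Tr-square : ∀ x → Tr (x * x) ≈ Tr x
  Tr-square x = +-cancelʳ x _ _ (trans (trace-square-shift (suc e) x) (+-congˡ (fermat x)))

  Tr[x²+x]≈0 : ∀ x → Tr (x * x + x) ≈ 0#
  Tr[x²+x]≈0 x = begin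
    Tr (x * x + x)       ≈⟨ trace-homo-+ (suc e) (x * x) x ⟩
    Tr (x * x) + Tr x    ≈⟨ +-congʳ (Tr-square x) ⟩
    Tr x + Tr x          ≈⟨ x+x≈0 (Tr x) ⟩
    0#                   ∎

  Tr[x+y²+y]≈Tr[x] : ∀ x y → Tr (x + (y * y + y)) ≈ Tr x
  Tr[x+y²+y]≈Tr[x] x y = begin
    Tr (x + (y * y + y))    ≈⟨ trace-homo-+ (suc e) x (y * y + y) ⟩
    Tr x + Tr (y * y + y)   ≈⟨ +-congˡ (Tr[x²+x]≈0 y) ⟩
    Tr x + 0#               ≈⟨ +-identityʳ (Tr x) ⟩
    Tr x                    ∎

  Tr≈1⇒x*x⁻¹≈1 : ∀ {x} → Tr x ≈ 1# → x * inv x ≈ 1#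
  Tr≈1⇒x*x⁻¹≈1 {x} Tr[x]≈1 = inverseʳ x λ x≈0 → 1≉0 (begin
    1#      ≈⟨ Tr[x]≈1 ⟨
    Tr x    ≈⟨ Tr-cong x≈0 ⟩
    Tr 0#   ≈⟨ trace-0 (suc e) ⟩
    0#      ∎)

  P≈A+a+a² : ∀ A → P R inv A ≈ A + inv A + inv A * inv A
  P≈A+a+a² A = +-congˡ (*-congˡ (*-identityʳ (inv A)))

  Tr-P : ∀ A → Tr (P R inv A) ≈ Tr A
  Tr-P A = begin
    Tr (P R inv A)         ≈⟨ Tr-cong (P≈A+a+a² A) ⟩
    Tr (A + a + a * a)     ≈⟨ Tr-cong (trans (+-assoc A a (a * a)) (+-congˡ (+-comm a (a * a)))) ⟩
    Tr (A + (a * a + a))   ≈⟨ Tr[x+y²+y]≈Tr[x] A a ⟩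
    Tr A                   ∎
    where a = inv A

  collision⇒Tr≈0 : ∀ {A B t} → A * inv A ≈ 1# → B * inv B ≈ 1# →
                   (inv A + inv B) * t ≈ 1# → P R inv A ≈ P R inv B → Tr A ≈ 0#
  collision⇒Tr≈0 {A} {B} {t} Aa≈1 Bb≈1 [a+b]t≈1 PA≈PB = begin
    Tr A                           ≈⟨ Tr-cong A≈ab+[b²+b] ⟩
    Tr (a * b + (b * b + b))       ≈⟨ Tr[x+y²+y]≈Tr[x] (a * b) b ⟩
    Tr (a * b)                     ≈⟨ Tr[x+y²+y]≈Tr[x] (a * b) t ⟨
    Tr (a * b + (t * t + t))       ≈⟨ Tr-cong abt²≈ab+[t²+t] ⟨
    Tr (a * b * (t * t))           ≈⟨ Tr-cong abt²≈[at]²+at ⟩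
    Tr (a * t * (a * t) + a * t)   ≈⟨ Tr[x²+x]≈0 (a * t) ⟩
    0#                             ∎
    where
    a = inv A
    b = inv B
    open Collision Aa≈1 Bb≈1 [a+b]t≈1 (trans (sym (P≈A+a+a² A)) (trans PA≈PB (P≈A+a+a² B)))

  P-injectiveOn : ∀ {A B} → Tr A ≈ 1# → Tr B ≈ 1# → P R inv A ≈ P R inv B → A ≈ B
  P-injectiveOn {A} {B} Tr[A]≈1 Tr[B]≈1 PA≈PB with inv A + inv B ≟ 0#
  ... | yes a+b≈0 = inverse-unique *-commutativeMonoid Aa≈1
                                   (trans (*-congˡ (x+y≈0⇒x≈y a+b≈0)) Bb≈1)
    where
    Aa≈1 = Tr≈1⇒x*x⁻¹≈1 Tr[A]≈1
    Bb≈1 = Tr≈1⇒x*x⁻¹≈1 Tr[B]≈1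
  ... | no a+b≉0  = contradiction (trans (sym Tr[A]≈1) Tr[A]≈0) 1≉0
    where
    Tr[A]≈0 = collision⇒Tr≈0 (Tr≈1⇒x*x⁻¹≈1 Tr[A]≈1) (Tr≈1⇒x*x⁻¹≈1 Tr[B]≈1)
                             (inverseʳ _ a+b≉0) PA≈PB

  P-surjectiveOn : ∀ {B} → Tr B ≈ 1# → ∃ λ A → Tr A ≈ 1# × P R inv A ≈ B
  P-surjectiveOn = surjectiveOn (λ x → Tr x ≟ 1#) (λ x≈y → trans (Tr-cong (sym x≈y)))
                                (λ {A} Tr[A]≈1 → trans (Tr-P A) Tr[A]≈1) P-injectiveOn

-- Imported only now: these operations on ℕ would clash with the ring operations opened above.
open import Data.Nat using (_^_; _*_; NonZero)

lemma2p4 : {c ℓ : Level} (e : ℕ) → NonZero e → (k : ℕ) → e ≡ 2 * k →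
    (R : CommutativeRing c ℓ) → (inv : CommutativeRing.Carrier R → CommutativeRing.Carrier R) →
    IsFiniteFieldOfOrder R (2 ^ e) inv →
    let open CommutativeRing R in
    ((A : Carrier) → trace R e A ≈ 1# → trace R e (P R inv A) ≈ 1#)
    × ((A B : Carrier) → trace R e A ≈ 1# → trace R e B ≈ 1# → P R inv A ≈ P R inv B → A ≈ B)
    × ((B : Carrier) → trace R e B ≈ 1# → Σ Carrier (λ A → (trace R e A ≈ 1#) × (P R inv A ≈ B)))
lemma2p4 (suc e) _ _ _ R inv F =
  (λ A Tr[A]≈1 → trans (Tr-P A) Tr[A]≈1) , (λ _ _ → P-injectiveOn) , (λ _ → P-surjectiveOn)
  where
  open CommutativeRing R using (trans)
  open BinaryField R inv e F
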